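{- Every rational solution $(a,b,c)$ of $(a-c)^2(b^2+1)=(b-c)^2(a^2+1)$ with $|a|\neq|b|$ is given by \[(a,b,c)=\left(a_1,b_1,\frac{a_1b_2+a_2b_1}{b_2+a_2}\right)\quad\text{or}\quad(a,b,c)=\left(a_1,b_1,\frac{a_1b_2-a_2b_1}{b_2-a_2}\right)\] for some rational solutions $(x,y)=(a_1,a_2)$ and $(x,y)=(b_1,b_2)$ of $x^2-dy^2=-1$, where $d$ is a square-free integer $\ge1$. -}

module Defs where

open import Data.Nat using (ℕ; _*_)
open import Data.Nat.Divisibility using (_∣_)
open import Data.Nat.Primality using (Prime)
open import Data.Integer using (+_)
open import Data.Rational using (ℚ; _/_)
open import Relation.Nullary using (¬_)

SquareFree : ℕ → Set
SquareFree d = ∀ p → Prime p → ¬ (p * p ∣ d)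

toℚ : ℕ → ℚ
toℚ d = + d / 1

{-# OPTIONS --safe #-}
-- Write a = i/q and factor q² + i² = d m² with d square-free, so that a² + 1 = d s² for
-- s = m/q. A solution has a ≠ c (a = c forces b = c, contradicting |a| ≠ |b|), so
-- r = (b - c)/(a - c) is defined and the equation reads b² + 1 = r² (a² + 1) = d (s r)².
-- Thus a₂ = s and b₂ = s r solve x² - d y² = -1, and (a - c) r = b - c rearranges to
-- c (b₂ - a₂) = a b₂ - a₂ b, where b₂ ≠ a₂ since r = 1 would give a = b.
module Submission where

open import Defs
open import Data.Nat using (ℕ; _≤_)
open import Data.Rational using (ℚ; _+_; _*_; _-_; -_; ∣_∣; 0ℚ; 1ℚ)
open import Data.Product using (Σ; _×_; ∃-syntax)
open import Data.Sum using (_⊎_)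
open import Relation.Binary.PropositionalEquality using (_≡_; _≢_)

open import Data.Product using (_,_)
open import Data.Sum using (inj₁; inj₂)
open import Function using (_∘_; it)
open import Relation.Nullary using (yes; no)
open import Relation.Nullary.Decidable using (_×-dec_)
open import Relation.Binary.PropositionalEquality
  using (refl; sym; trans; cong; cong₂; subst; module ≡-Reasoning)

open import Data.Nat as ℕ using (NonZero; suc; s≤s; _<_)
import Data.Nat.Properties as ℕ
open import Data.Nat.Divisibility using (_∣_; _∣?_; divides; ∣⇒≤)
open import Data.Nat.Primality using (Prime; prime?; prime⇒nonZero; prime⇒nonTrivial)
open import Data.Nat.Induction using (<-rec)
open import Data.Nat.Tactic.RingSolver using () renaming (solve-∀ to ℕ-solve-∀)

open import Data.Integer as ℤ using (ℤ; +_; -[1+_])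
import Data.Integer.Properties as ℤ
open import Data.Integer.Tactic.RingSolver using () renaming (solve-∀ to ℤ-solve-∀)

open import Data.Rational as ℚ using (mkℚ; ↥_; ↧ₙ_; _/_; _÷_; 1/_; _≟_; Positive; ≢-nonZero)
open import Data.Rational.Properties
  using ( *-identityˡ; *-identityʳ; *-assoc; *-comm; *-zeroˡ; *-zeroʳ; +-inverseʳ; *-inverseˡ; *-inverseʳ
        ; +-0-group; <-irrefl; positive⁻¹; pos⇒nonZero; pos*pos⇒pos; 1/pos⇒pos; normalize-pos
        ; toℚᵘ-injective; toℚᵘ-fromℚᵘ; toℚᵘ-homo-+; toℚᵘ-homo-* )
open import Data.Rational.Unnormalised as ℚᵘ using (mkℚᵘ; *≡*; _≃_)
import Data.Rational.Unnormalised.Properties as ℚᵘ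
open import Data.Rational.Solver using (module +-*-Solver)
open +-*-Solver using (solve; _:+_; _:*_; _:-_; :-_; con; _:=_)
open import Algebra.Properties.Group +-0-group using (∙-cancelʳ) renaming (x∙y⁻¹≈ε⇒x≈y to p-q≡0⇒p≡q)

squareFree⊎primeSquare∣ : ∀ n .{{_ : NonZero n}} → SquareFree n ⊎ ∃[ p ] (Prime p × p ℕ.* p ∣ n)
squareFree⊎primeSquare∣ n with ℕ.anyUpTo? (λ p → prime? p ×-dec p ℕ.* p ∣? n) (suc n)
... | yes (p , _ , p-prime , p²∣n) = inj₂ (p , p-prime , p²∣n)
... | no ∄p = inj₁ λ p p-prime p²∣n → ∄p (p , s≤s (p≤n p-prime p²∣n) , p-prime , p²∣n)
  where
  p≤n : ∀ {p} → Prime p → p ℕ.* p ∣ n → p ≤ n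
  p≤n {p} p-prime p²∣n = ℕ.≤-trans (ℕ.m≤m*n p p {{prime⇒nonZero p-prime}}) (∣⇒≤ p²∣n)

SquareFreeDecomposition : ℕ → Set
SquareFreeDecomposition n = ∃[ d ] ∃[ m ] (1 ≤ d × SquareFree d × n ≡ d ℕ.* (m ℕ.* m))

*-square-decomposition : ∀ {k} p → SquareFreeDecomposition k → SquareFreeDecomposition (k ℕ.* (p ℕ.* p))
*-square-decomposition p (d , m , 1≤d , d-sf , k≡dm²) =
  d , m ℕ.* p , 1≤d , d-sf , trans (cong (ℕ._* (p ℕ.* p)) k≡dm²) (d*m²*p²≡d*[m*p]² d m p)
  where
  d*m²*p²≡d*[m*p]² : ∀ d m p → d ℕ.* (m ℕ.* m) ℕ.* (p ℕ.* p) ≡ d ℕ.* ((m ℕ.* p) ℕ.* (m ℕ.* p))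
  d*m²*p²≡d*[m*p]² = ℕ-solve-∀

squareFree-decomposition : ∀ n .{{_ : NonZero n}} → SquareFreeDecomposition n
squareFree-decomposition = <-rec (λ n → .{{NonZero n}} → SquareFreeDecomposition n) decompose
  where
  decompose : ∀ n → (∀ {k} → k < n → .{{NonZero k}} → SquareFreeDecomposition k) →
              .{{NonZero n}} → SquareFreeDecomposition n
  decompose n rec with squareFree⊎primeSquare∣ n
  ... | inj₁ n-sf = n , 1 , ℕ.>-nonZero⁻¹ n , n-sf , sym (ℕ.*-identityʳ n)
  ... | inj₂ (p , p-prime , divides k n≡k*p²) =
    subst SquareFreeDecomposition (sym n≡k*p²) (*-square-decomposition p (rec k<n))
    where
    instance k≢0 = ℕ.m*n≢0⇒m≢0 k {{subst NonZero n≡k*p² it}}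
    k<n : k < n
    k<n = subst (k <_) (sym n≡k*p²) (ℕ.m<m*n k (p ℕ.* p) (ℕ.*-mono-< p>1 p>1))
      where p>1 = ℕ.nonTrivial⇒n>1 p {{prime⇒nonTrivial p-prime}}

-- toℚ n is definitionally fromℤ (+ n).
fromℤ : ℤ → ℚ
fromℤ i = i / 1

toℚᵘ-fromℤ : ∀ i → ℚ.toℚᵘ (fromℤ i) ≃ mkℚᵘ i 0
toℚᵘ-fromℤ i = toℚᵘ-fromℚᵘ (mkℚᵘ i 0)

fromℤ-+ : ∀ i j → fromℤ (i ℤ.+ j) ≡ fromℤ i + fromℤ j
fromℤ-+ i j = toℚᵘ-injective (begin
  ℚ.toℚᵘ (fromℤ (i ℤ.+ j))                  ≈⟨ toℚᵘ-fromℤ (i ℤ.+ j) ⟩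
  mkℚᵘ (i ℤ.+ j) 0                           ≈⟨ *≡* ([i+j]*1≡[i*1+j*1]*1 i j) ⟩
  mkℚᵘ i 0 ℚᵘ.+ mkℚᵘ j 0                     ≈⟨ ℚᵘ.+-cong (toℚᵘ-fromℤ i) (toℚᵘ-fromℤ j) ⟨
  ℚ.toℚᵘ (fromℤ i) ℚᵘ.+ ℚ.toℚᵘ (fromℤ j)     ≈⟨ toℚᵘ-homo-+ (fromℤ i) (fromℤ j) ⟨
  ℚ.toℚᵘ (fromℤ i + fromℤ j)                ∎)
  where
  open ℚᵘ.≃-Reasoning
  [i+j]*1≡[i*1+j*1]*1 : ∀ i j → (i ℤ.+ j) ℤ.* + 1 ≡ (i ℤ.* + 1 ℤ.+ j ℤ.* + 1) ℤ.* + 1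
  [i+j]*1≡[i*1+j*1]*1 = ℤ-solve-∀

fromℤ-* : ∀ i j → fromℤ (i ℤ.* j) ≡ fromℤ i * fromℤ j
fromℤ-* i j = toℚᵘ-injective (begin
  ℚ.toℚᵘ (fromℤ (i ℤ.* j))                  ≈⟨ toℚᵘ-fromℤ (i ℤ.* j) ⟩
  mkℚᵘ i 0 ℚᵘ.* mkℚᵘ j 0                     ≈⟨ ℚᵘ.*-cong (toℚᵘ-fromℤ i) (toℚᵘ-fromℤ j) ⟨
  ℚ.toℚᵘ (fromℤ i) ℚᵘ.* ℚ.toℚᵘ (fromℤ j)     ≈⟨ toℚᵘ-homo-* (fromℤ i) (fromℤ j) ⟨
  ℚ.toℚᵘ (fromℤ i * fromℤ j)                ∎)
  where open ℚᵘ.≃-Reasoning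

p*↧p≡↥p : ∀ p → p * toℚ (↧ₙ p) ≡ fromℤ (↥ p)
p*↧p≡↥p p@(mkℚ i d-1 _) = toℚᵘ-injective (begin
  ℚ.toℚᵘ (p * toℚ d)                   ≈⟨ toℚᵘ-homo-* p (toℚ d) ⟩
  ℚ.toℚᵘ p ℚᵘ.* ℚ.toℚᵘ (toℚ d)          ≈⟨ ℚᵘ.*-congˡ {ℚ.toℚᵘ p} (toℚᵘ-fromℤ (+ d)) ⟩
  mkℚᵘ i d-1 ℚᵘ.* mkℚᵘ (+ d) 0          ≈⟨ *≡* [i*d]*1≡i*[d*1] ⟩
  mkℚᵘ i 0                              ≈⟨ toℚᵘ-fromℤ i ⟨
  ℚ.toℚᵘ (fromℤ i)                      ∎)
  where
  open ℚᵘ.≃-Reasoning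
  d = suc d-1
  [i*d]*1≡i*[d*1] : (i ℤ.* + d) ℤ.* + 1 ≡ i ℤ.* + (d ℕ.* 1)
  [i*d]*1≡i*[d*1] = trans (ℤ.*-identityʳ (i ℤ.* + d)) (cong (λ n → i ℤ.* + n) (sym (ℕ.*-identityʳ d)))

i*i≡+∣i∣*∣i∣ : ∀ i → i ℤ.* i ≡ + (ℤ.∣ i ∣ ℕ.* ℤ.∣ i ∣)
i*i≡+∣i∣*∣i∣ (+ n)     = sym (ℤ.pos-* n n)
i*i≡+∣i∣*∣i∣ -[1+ n ] = refl

fromℤ-sumOfSquares : ∀ q i d m → q ℕ.* q ℕ.+ ℤ.∣ i ∣ ℕ.* ℤ.∣ i ∣ ≡ d ℕ.* (m ℕ.* m) →
                     toℚ q * toℚ q + fromℤ i * fromℤ i ≡ toℚ d * (toℚ m * toℚ m)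
fromℤ-sumOfSquares q i d m q²+i²≡dm² = begin
  toℚ q * toℚ q + fromℤ i * fromℤ i        ≡⟨ cong₂ _+_ (fromℤ-* (+ q) (+ q)) (fromℤ-* i i) ⟨
  fromℤ (+ q ℤ.* + q) + fromℤ (i ℤ.* i)   ≡⟨ fromℤ-+ (+ q ℤ.* + q) (i ℤ.* i) ⟨
  fromℤ (+ q ℤ.* + q ℤ.+ i ℤ.* i)         ≡⟨ cong fromℤ ℤ-identity ⟩
  fromℤ (+ d ℤ.* (+ m ℤ.* + m))           ≡⟨ fromℤ-* (+ d) (+ m ℤ.* + m) ⟩
  toℚ d * fromℤ (+ m ℤ.* + m)             ≡⟨ cong (toℚ d *_) (fromℤ-* (+ m) (+ m)) ⟩
  toℚ d * (toℚ m * toℚ m)                 ∎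
  where
  open ≡-Reasoning
  ℤ-identity : + q ℤ.* + q ℤ.+ i ℤ.* i ≡ + d ℤ.* (+ m ℤ.* + m)
  ℤ-identity = begin
    + q ℤ.* + q ℤ.+ i ℤ.* i                  ≡⟨ cong₂ ℤ._+_ (sym (ℤ.pos-* q q)) (i*i≡+∣i∣*∣i∣ i) ⟩
    + (q ℕ.* q) ℤ.+ + (ℤ.∣ i ∣ ℕ.* ℤ.∣ i ∣)   ≡⟨ ℤ.pos-+ (q ℕ.* q) (ℤ.∣ i ∣ ℕ.* ℤ.∣ i ∣) ⟨
    + (q ℕ.* q ℕ.+ ℤ.∣ i ∣ ℕ.* ℤ.∣ i ∣)       ≡⟨ cong +_ q²+i²≡dm² ⟩
    + (d ℕ.* (m ℕ.* m))                       ≡⟨ ℤ.pos-* d (m ℕ.* m) ⟩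
    + d ℤ.* + (m ℕ.* m)                       ≡⟨ cong (+ d ℤ.*_) (ℤ.pos-* m m) ⟩
    + d ℤ.* (+ m ℤ.* + m)                     ∎

*-cancelˡ-≡ : ∀ {p q r} → p ≢ 0ℚ → p * q ≡ p * r → q ≡ r
*-cancelˡ-≡ {p} {q} {r} p≢0 pq≡pr = begin
  q               ≡⟨ *-identityˡ q ⟨
  1ℚ * q          ≡⟨ cong (_* q) (*-inverseˡ p) ⟨
  1/ p * p * q    ≡⟨ *-assoc (1/ p) p q ⟩
  1/ p * (p * q)  ≡⟨ cong (1/ p *_) pq≡pr ⟩
  1/ p * (p * r)  ≡⟨ *-assoc (1/ p) p r ⟨
  1/ p * p * r    ≡⟨ cong (_* r) (*-inverseˡ p) ⟩
  1ℚ * r          ≡⟨ *-identityˡ r ⟩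
  r               ∎
  where
  open ≡-Reasoning
  instance _ = ≢-nonZero p≢0

p*q≡0⇒q≡0 : ∀ {p q} → p ≢ 0ℚ → p * q ≡ 0ℚ → q ≡ 0ℚ
p*q≡0⇒q≡0 {p} p≢0 pq≡0 = *-cancelˡ-≡ p≢0 (trans pq≡0 (sym (*-zeroʳ p)))

p*q≢0 : ∀ {p q} → p ≢ 0ℚ → q ≢ 0ℚ → p * q ≢ 0ℚ
p*q≢0 p≢0 q≢0 = q≢0 ∘ p*q≡0⇒q≡0 p≢0

p*p≡0⇒p≡0 : ∀ p → p * p ≡ 0ℚ → p ≡ 0ℚ
p*p≡0⇒p≡0 p pp≡0 with p ≟ 0ℚ
... | yes p≡0 = p≡0
... | no  p≢0 = p*q≡0⇒q≡0 p≢0 pp≡0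

p*q≡r⇒p≡r÷q : ∀ {p q r} .{{_ : ℚ.NonZero q}} → p * q ≡ r → p ≡ r ÷ q
p*q≡r⇒p≡r÷q {p} {q} {r} pq≡r = begin
  p                ≡⟨ *-identityʳ p ⟨
  p * 1ℚ           ≡⟨ cong (p *_) (*-inverseʳ q) ⟨
  p * (q * 1/ q)   ≡⟨ *-assoc p q (1/ q) ⟨
  p * q * 1/ q     ≡⟨ cong (_* 1/ q) pq≡r ⟩
  r * 1/ q         ∎
  where open ≡-Reasoning

p*[q÷p]≡q : ∀ p q .{{_ : ℚ.NonZero p}} → p * (q ÷ p) ≡ q
p*[q÷p]≡q p q = begin
  p * (q * 1/ p)   ≡⟨ solve 3 (λ p q i → p :* (q :* i) := q :* (p :* i)) refl p q (1/ p) ⟩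
  q * (p * 1/ p)   ≡⟨ cong (q *_) (*-inverseʳ p) ⟩
  q * 1ℚ           ≡⟨ *-identityʳ q ⟩
  q                ∎
  where open ≡-Reasoning

pos⇒≢0 : ∀ p .{{_ : Positive p}} → p ≢ 0ℚ
pos⇒≢0 p p≡0 = <-irrefl (sym p≡0) (positive⁻¹ p)

toℚ-pos : ∀ n .{{_ : NonZero n}} → Positive (toℚ n)
toℚ-pos n = normalize-pos n 1

x²+1≡Dy²⇒x²-Dy²≡-1 : ∀ x D y → x * x + 1ℚ ≡ D * (y * y) → x * x - D * (y * y) ≡ - 1ℚ
x²+1≡Dy²⇒x²-Dy²≡-1 x D y x²+1≡Dy² = begin
  x * x - D * (y * y)     ≡⟨ cong (λ t → x * x - t) x²+1≡Dy² ⟨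
  x * x - (x * x + 1ℚ)    ≡⟨ solve 1 (λ x → x :* x :- (x :* x :+ con 1ℚ) := :- con 1ℚ) refl x ⟩
  - 1ℚ                    ∎
  where open ≡-Reasoning

y²+x²≡Dm²⇒[x/y]²+1≡D[m/y]² : ∀ x y D m .{{_ : ℚ.NonZero y}} → y * y + x * x ≡ D * (m * m) →
                               (x ÷ y) * (x ÷ y) + 1ℚ ≡ D * ((m ÷ y) * (m ÷ y))
y²+x²≡Dm²⇒[x/y]²+1≡D[m/y]² x y D m y²+x²≡Dm² = begin
  (x * i) * (x * i) + 1ℚ               ≡⟨ cong (_+_ ((x * i) * (x * i))) [y*i]²≡1 ⟨
  (x * i) * (x * i) + (y * i) * (y * i) ≡⟨ solve 3 (λ x y i → (x :* i) :* (x :* i) :+ (y :* i) :* (y :* i)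
                                                         := (y :* y :+ x :* x) :* (i :* i)) refl x y i ⟩
  (y * y + x * x) * (i * i)            ≡⟨ cong (_* (i * i)) y²+x²≡Dm² ⟩
  D * (m * m) * (i * i)                ≡⟨ solve 3 (λ D m i → D :* (m :* m) :* (i :* i)
                                                         := D :* ((m :* i) :* (m :* i))) refl D m i ⟩
  D * ((m * i) * (m * i))              ∎
  where
  open ≡-Reasoning
  i = 1/ y
  [y*i]²≡1 : (y * i) * (y * i) ≡ 1ℚ
  [y*i]²≡1 = trans (cong₂ _*_ (*-inverseʳ y) (*-inverseʳ y)) (*-identityˡ 1ℚ)

a²+1≡d*s² : ∀ a → ∃[ d ] ∃[ s ] (1 ≤ d × SquareFree d × s ≢ 0ℚ × a * a + 1ℚ ≡ toℚ d * (s * s))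
a²+1≡d*s² a@(mkℚ i q-1 _) with squareFree-decomposition (suc q-1 ℕ.* suc q-1 ℕ.+ ℤ.∣ i ∣ ℕ.* ℤ.∣ i ∣)
... | d , m , 1≤d , d-sf , q²+i²≡dm² =
  d , toℚ m ÷ toℚ q , 1≤d , d-sf , pos⇒≢0 (toℚ m ÷ toℚ q) {{s-pos}} ,
  subst (λ x → x * x + 1ℚ ≡ toℚ d * ((toℚ m ÷ toℚ q) * (toℚ m ÷ toℚ q)))
        (sym a≡i÷q)
        (y²+x²≡Dm²⇒[x/y]²+1≡D[m/y]² (fromℤ i) (toℚ q) (toℚ d) (toℚ m)
          (fromℤ-sumOfSquares q i d m q²+i²≡dm²))
  where
  q = suc q-1
  instance
    q-pos = toℚ-pos q
    q-nonZero = pos⇒nonZero (toℚ q)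
    m-nonZero : NonZero m
    m-nonZero = ℕ.m*n≢0⇒m≢0 m {{ℕ.m*n≢0⇒n≢0 d {{subst NonZero q²+i²≡dm² _}}}}
    m-pos = toℚ-pos m
    1/q-pos = 1/pos⇒pos (toℚ q)
  a≡i÷q : a ≡ fromℤ i ÷ toℚ q
  a≡i÷q = p*q≡r⇒p≡r÷q (p*↧p≡↥p a)
  s-pos : Positive (toℚ m ÷ toℚ q)
  s-pos = pos*pos⇒pos (toℚ m) (1/ toℚ q)

OnCurve : ℚ → ℚ → ℚ → Set
OnCurve a b c = (a - c) * (a - c) * (b * b + 1ℚ) ≡ (b - c) * (b - c) * (a * a + 1ℚ)

onCurve∧a≡c⇒b≡c : ∀ {a b c} → a * a + 1ℚ ≢ 0ℚ → OnCurve a b c → a ≡ c → b ≡ c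
onCurve∧a≡c⇒b≡c {a} {b} a²+1≢0 curve refl =
  p-q≡0⇒p≡q b a (p*p≡0⇒p≡0 (b - a) (p*q≡0⇒q≡0 a²+1≢0 [a²+1][b-a]²≡0))
  where
  open ≡-Reasoning
  [a²+1][b-a]²≡0 : (a * a + 1ℚ) * ((b - a) * (b - a)) ≡ 0ℚ
  [a²+1][b-a]²≡0 = begin
    (a * a + 1ℚ) * ((b - a) * (b - a))   ≡⟨ *-comm (a * a + 1ℚ) ((b - a) * (b - a)) ⟩
    (b - a) * (b - a) * (a * a + 1ℚ)     ≡⟨ curve ⟨
    (a - a) * (a - a) * (b * b + 1ℚ)     ≡⟨ cong (λ t → t * t * (b * b + 1ℚ)) (+-inverseʳ a) ⟩
    0ℚ * 0ℚ * (b * b + 1ℚ)               ≡⟨ *-zeroˡ (b * b + 1ℚ) ⟩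
    0ℚ                                   ∎

u²B≡[ur]²A⇒B≡r²A : ∀ {u r A B} → u ≢ 0ℚ → u * u * B ≡ (u * r) * (u * r) * A → B ≡ r * r * A
u²B≡[ur]²A⇒B≡r²A {u} {r} {A} {B} u≢0 u²B≡[ur]²A = *-cancelˡ-≡ (p*q≢0 u≢0 u≢0) (begin
  u * u * B               ≡⟨ u²B≡[ur]²A ⟩
  (u * r) * (u * r) * A   ≡⟨ solve 3 (λ u r A → (u :* r) :* (u :* r) :* A
                                         := u :* u :* (r :* r :* A)) refl u r A ⟩
  u * u * (r * r * A)     ∎)
  where open ≡-Reasoning

c[sr-s]≡a[sr]-sb : ∀ a b c s r → (a - c) * r ≡ b - c → c * (s * r - s) ≡ a * (s * r) - s * b
c[sr-s]≡a[sr]-sb a b c s r [a-c]r≡b-c = begin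
  c * (s * r - s)
    ≡⟨ solve 5 (λ a b c s r → c :* (s :* r :- s)
                  := a :* (s :* r) :- s :* b :- s :* ((a :- c) :* r :- (b :- c))) refl a b c s r ⟩
  a * (s * r) - s * b - s * ((a - c) * r - (b - c))
    ≡⟨ cong (λ t → a * (s * r) - s * b - s * (t - (b - c))) [a-c]r≡b-c ⟩
  a * (s * r) - s * b - s * ((b - c) - (b - c))
    ≡⟨ solve 5 (λ a b s r w → a :* (s :* r) :- s :* b :- s :* (w :- w)
                  := a :* (s :* r) :- s :* b) refl a b s r (b - c) ⟩
  a * (s * r) - s * b
    ∎
  where open ≡-Reasoning

sr-s≢0 : ∀ {a b c s r} → s ≢ 0ℚ → a ≢ b → (a - c) * r ≡ b - c → s * r - s ≢ 0ℚ
sr-s≢0 {a} {b} {c} {s} {r} s≢0 a≢b [a-c]r≡b-c sr-s≡0 = a≢b (∙-cancelʳ (- c) a b a-c≡b-c)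
  where
  s[r-1]≡0 : s * (r - 1ℚ) ≡ 0ℚ
  s[r-1]≡0 = trans (solve 2 (λ s r → s :* (r :- con 1ℚ) := s :* r :- s) refl s r) sr-s≡0
  r≡1 : r ≡ 1ℚ
  r≡1 = p-q≡0⇒p≡q r 1ℚ (p*q≡0⇒q≡0 s≢0 s[r-1]≡0)
  a-c≡b-c : a - c ≡ b - c
  a-c≡b-c = trans (sym (*-identityʳ (a - c))) (trans (cong ((a - c) *_) (sym r≡1)) [a-c]r≡b-c)

onCurve⇒b²+1≡r²[a²+1] : ∀ {a b c} → a * a + 1ℚ ≢ 0ℚ → a ≢ b → OnCurve a b c →
                         ∃[ r ] ((a - c) * r ≡ b - c × b * b + 1ℚ ≡ r * r * (a * a + 1ℚ))
onCurve⇒b²+1≡r²[a²+1] {a} {b} {c} a²+1≢0 a≢b curve =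
  r , [a-c]r≡b-c ,
  u²B≡[ur]²A⇒B≡r²A a-c≢0
    (subst (λ w → (a - c) * (a - c) * (b * b + 1ℚ) ≡ w * w * (a * a + 1ℚ)) (sym [a-c]r≡b-c) curve)
  where
  a-c≢0 : a - c ≢ 0ℚ
  a-c≢0 a-c≡0 = a≢b (trans a≡c (sym (onCurve∧a≡c⇒b≡c a²+1≢0 curve a≡c)))
    where a≡c = p-q≡0⇒p≡q a c a-c≡0
  instance _ = ≢-nonZero a-c≢0
  r = (b - c) ÷ (a - c)
  [a-c]r≡b-c : (a - c) * r ≡ b - c
  [a-c]r≡b-c = p*[q÷p]≡q (a - c) (b - c)

x²+1≡Dy²∧z²+1≡r²[x²+1]⇒z²+1≡D[yr]² : ∀ x z D y r → x * x + 1ℚ ≡ D * (y * y) →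
                                      z * z + 1ℚ ≡ r * r * (x * x + 1ℚ) → z * z + 1ℚ ≡ D * ((y * r) * (y * r))
x²+1≡Dy²∧z²+1≡r²[x²+1]⇒z²+1≡D[yr]² x z D y r x²+1≡Dy² z²+1≡r²[x²+1] = begin
  z * z + 1ℚ              ≡⟨ z²+1≡r²[x²+1] ⟩
  r * r * (x * x + 1ℚ)    ≡⟨ cong (r * r *_) x²+1≡Dy² ⟩
  r * r * (D * (y * y))   ≡⟨ solve 3 (λ r D y → r :* r :* (D :* (y :* y))
                                         := D :* ((y :* r) :* (y :* r))) refl r D y ⟩
  D * ((y * r) * (y * r)) ∎
  where open ≡-Reasoning

proposition1 : (a b c : ℚ) →
    (a - c) * (a - c) * (b * b + 1ℚ) ≡ (b - c) * (b - c) * (a * a + 1ℚ) →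
    ∣ a ∣ ≢ ∣ b ∣ →
    ∃[ d ] ∃[ a₂ ] ∃[ b₂ ]
      (1 ≤ d × SquareFree d
        × a * a - toℚ d * (a₂ * a₂) ≡ - 1ℚ
        × b * b - toℚ d * (b₂ * b₂) ≡ - 1ℚ
        × ((b₂ + a₂ ≢ 0ℚ × c * (b₂ + a₂) ≡ a * b₂ + a₂ * b)
           ⊎ (b₂ - a₂ ≢ 0ℚ × c * (b₂ - a₂) ≡ a * b₂ - a₂ * b)))
proposition1 a b c curve ∣a∣≢∣b∣ with a²+1≡d*s² a
... | d , s , 1≤d , d-sf , s≢0 , a²+1≡ds² =
  let r , [a-c]r≡b-c , b²+1≡r²[a²+1] = onCurve⇒b²+1≡r²[a²+1] a²+1≢0 a≢b curve
  in d , s , s * r , 1≤d , d-sf ,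
     x²+1≡Dy²⇒x²-Dy²≡-1 a (toℚ d) s a²+1≡ds² ,
     x²+1≡Dy²⇒x²-Dy²≡-1 b (toℚ d) (s * r)
       (x²+1≡Dy²∧z²+1≡r²[x²+1]⇒z²+1≡D[yr]² a b (toℚ d) s r a²+1≡ds² b²+1≡r²[a²+1]) ,
     inj₂ (sr-s≢0 s≢0 a≢b [a-c]r≡b-c , c[sr-s]≡a[sr]-sb a b c s r [a-c]r≡b-c)
  where
  a≢b : a ≢ b
  a≢b = ∣a∣≢∣b∣ ∘ cong ∣_∣
  a²+1≢0 : a * a + 1ℚ ≢ 0ℚ
  a²+1≢0 = subst (_≢ 0ℚ) (sym a²+1≡ds²)
    (p*q≢0 (pos⇒≢0 (toℚ d) {{toℚ-pos d {{ℕ.>-nonZero 1≤d}}}}) (p*q≢0 s≢0 s≢0))
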